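{- Let $U$ be an $n\times n$ Gaussian rational unitary matrix with $Ue=e$ and $\ell(U)=1+i$. Then there exist permutation matrices $P$ and $Q$ and an integer $k\ge1$ such that $PUQ=U_{k,n-2k}$.
   Context: $e$ is the all-one vector. A Gaussian rational matrix has entries with rational real and imaginary parts; $U$ is unitary if $U^*U=I$. Let $\Gamma=\{z\in\mathbb{Z}[i]:\mathrm{Re}(z)>0,\mathrm{Im}(z)\ge0\}$; the level $\ell(U)$ is the unique $\ell\in\Gamma$ with $\ell U$ Gaussian integral and $N(\ell)=|\ell|^2$ minimal. Let $U_0=\frac{1}{1+i}\begin{pmatrix}1&i\\ i&1\end{pmatrix}$, and for $k\ge1$, $s\ge0$ let $U_{k,s}$ be the block diagonal matrix of order $2k+s$ with $k$ diagonal blocks equal to $U_0$ followed by the identity matrix $I_s$. -}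

module Defs where

open import Data.Nat using (ℕ; zero; suc; _*_; _≤_; _+_)
open import Data.Integer as ℤ using (ℤ; +_; _>_; _≥_)
open import Data.Rational as ℚ using (ℚ; _/_; 0ℚ; 1ℚ; ½; -½)
open import Data.Fin using (Fin; zero; suc)
open import Data.Fin.Permutation using (Permutation′; _⟨$⟩ʳ_)
open import Data.Product using (Σ; _×_; ∃)
open import Relation.Binary.PropositionalEquality using (_≡_)
open import Relation.Nullary using (yes; no)
open import Data.Fin using (_≟_)

record GQ : Set where
  constructor _+i_
  field
    re : ℚ
    im : ℚ
open GQ public

_⊕_ : GQ → GQ → GQ
(a +i b) ⊕ (c +i d) = (a ℚ.+ c) +i (b ℚ.+ d)

_⊛_ : GQ → GQ → GQ
(a +i b) ⊛ (c +i d) = ((a ℚ.* c) ℚ.- (b ℚ.* d)) +i ((a ℚ.* d) ℚ.+ (b ℚ.* c))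

conj : GQ → GQ
conj (a +i b) = a +i (ℚ.- b)

𝟘 𝟙 𝕚 : GQ
𝟘 = 0ℚ +i 0ℚ
𝟙 = 1ℚ +i 0ℚ
𝕚 = 0ℚ +i 1ℚ

IsIntℚ : ℚ → Set
IsIntℚ q = ∃ λ (z : ℤ) → q ≡ z / 1

IsGaussInt : GQ → Set
IsGaussInt z = IsIntℚ (re z) × IsIntℚ (im z)

record GZ : Set where
  constructor gz
  field
    gre : ℤ
    gim : ℤ
open GZ public

toGQ : GZ → GQ
toGQ (gz a b) = (a / 1) +i (b / 1)

InΓ : GZ → Set
InΓ (gz a b) = (a > + 0) × (b ≥ + 0)

N : GZ → ℤ
N (gz a b) = a ℤ.* a ℤ.+ b ℤ.* b

Mat : ℕ → Set
Mat n = Fin n → Fin n → GQ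

Σᶠ : (n : ℕ) → (Fin n → GQ) → GQ
Σᶠ zero f = 𝟘
Σᶠ (suc n) f = f zero ⊕ Σᶠ n (λ i → f (suc i))

_·_ : ∀ {n} → Mat n → Mat n → Mat n
_·_ {n} A B i j = Σᶠ n (λ k → A i k ⊛ B k j)

_* : ∀ {n} → Mat n → Mat n
(A *) i j = conj (A j i)

I : ∀ {n} → Mat n
I i j with i ≟ j
... | yes _ = 𝟙
... | no _ = 𝟘

scale : ∀ {n} → GQ → Mat n → Mat n
scale c A i j = c ⊛ A i j

IsUnitary : ∀ {n} → Mat n → Set
IsUnitary U = ∀ i j → ((U *) · U) i j ≡ I i j

FixesOnes : ∀ {n} → Mat n → Set
FixesOnes {n} U = ∀ i → Σᶠ n (λ j → U i j) ≡ 𝟙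

IsGaussIntMat : ∀ {n} → Mat n → Set
IsGaussIntMat U = ∀ i j → IsGaussInt (U i j)

IsLevel : ∀ {n} → Mat n → GZ → Set
IsLevel U ℓ = InΓ ℓ × IsGaussIntMat (scale (toGQ ℓ) U)
  × (∀ ℓ' → InΓ ℓ' → IsGaussIntMat (scale (toGQ ℓ') U) → N ℓ ℤ.≤ N ℓ')

PermMat : ∀ {n} → Permutation′ n → Mat n
PermMat π i j with (π ⟨$⟩ʳ i) ≟ j
... | yes _ = 𝟙
... | no _ = 𝟘

-- 1/(1+i) = 1/2 - i/2
inv1+i : GQ
inv1+i = ½ +i -½

U₀ : Fin 2 → Fin 2 → GQ
U₀ zero zero = inv1+i ⊛ 𝟙
U₀ zero (suc zero) = inv1+i ⊛ 𝕚
U₀ (suc zero) zero = inv1+i ⊛ 𝕚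
U₀ (suc zero) (suc zero) = inv1+i ⊛ 𝟙

-- U_{k,s}: block diagonal, k blocks U₀ followed by I_s; order k*2+s (= 2k+s)
Ublk : (k s : ℕ) → Mat (k * 2 + s)
Ublk zero s = I
Ublk (suc k) s zero zero = U₀ zero zero
Ublk (suc k) s zero (suc zero) = U₀ zero (suc zero)
Ublk (suc k) s (suc zero) zero = U₀ (suc zero) zero
Ublk (suc k) s (suc zero) (suc zero) = U₀ (suc zero) (suc zero)
Ublk (suc k) s zero (suc (suc j)) = 𝟘
Ublk (suc k) s (suc zero) (suc (suc j)) = 𝟘
Ublk (suc k) s (suc (suc i)) zero = 𝟘
Ublk (suc k) s (suc (suc i)) (suc zero) = 𝟘
Ublk (suc k) s (suc (suc i)) (suc (suc j)) = Ublk k s i j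

castMat : ∀ {m n} → m ≡ n → Mat m → Mat n
castMat Relation.Binary.PropositionalEquality.refl A = A

-- Put V = (1 + i) U, a Gaussian integer matrix. Unitarity gives V* V = 2 I, so every
-- column of V has squared norm 2 and all entries have norm at most 2; the rows of V sum
-- to 1 + i. An entry of norm 2 is alone in its column, orthogonality clears the rest of
-- its row, and the row sum makes it 1 + i. A unit entry has exactly one other unit in its
-- column, say in rows r and s; orthogonality and the row sums then force rows r and s to
-- be supported on two columns carrying the block [[1, i], [i, 1]]. Peeling off such blocks
-- leaves (1 + i) times a permutation matrix, and at least one block occurs, since
-- otherwise U would be a permutation matrix, of level 1.

module Submission where

open import Defs
open import Algebra.Bundles using (CommutativeMonoid)
open import Data.Empty using (⊥-elim)
open import Data.Fin using (Fin; zero; suc; punchIn; punchOut)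
import Data.Fin.Properties as Finₚ
open import Data.Fin.Permutation as Perm using (Permutation′; _⟨$⟩ʳ_; _⟨$⟩ˡ_; insert; insert-punchIn)
open import Data.Integer as ℤ using (ℤ; +_; -[1+_])
import Data.Integer.Properties as ℤₚ
open import Data.Integer.Solver renaming (module +-*-Solver to ℤ-Solver)
open import Data.Nat using (ℕ; zero; suc; _*_; _+_; _≤_; _<_; z≤n; s≤s)
import Data.Nat.Properties as ℕₚ
open import Data.Product using (Σ; _×_; _,_; proj₁; proj₂; ∃)
open import Data.Rational as ℚ using (ℚ; _/_; 0ℚ; 1ℚ; ½; -½)
import Data.Rational.Properties as ℚₚ
open import Data.Rational.Solver renaming (module +-*-Solver to ℚ-Solver)
open import Data.Rational.Unnormalised as ℚᵘ using (mkℚᵘ; *≡*)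
import Data.Rational.Unnormalised.Properties as ℚᵘₚ
open import Data.Sum using (_⊎_; inj₁; inj₂)
open import Data.Unit using (tt)
import Data.Vec.Functional as Vector
open import Function using (_∘_)
open import Level using (0ℓ)
open import Relation.Binary.PropositionalEquality
open import Relation.Nullary using (¬_; Dec; yes; no; contradiction)
open import Relation.Nullary.Decidable using (map′; toWitness; decidable-stable)
open import Relation.Nullary.Decidable.Core using (_→-dec_; _×-dec_; _⊎-dec_; ¬?)

infixl 6 _+ᴳ_

_+ᴳ_ : GZ → GZ → GZ
gz a b +ᴳ gz c d = gz (a ℤ.+ c) (b ℤ.+ d)

0ᴳ 1+i : GZ
0ᴳ = gz (+ 0) (+ 0)
1+i = gz (+ 1) (+ 1)

_*ᴳ_ : GZ → GZ → GZ
gz a b *ᴳ gz c d = gz (a ℤ.* c ℤ.- b ℤ.* d) (a ℤ.* d ℤ.+ b ℤ.* c)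

conjᴳ : GZ → GZ
conjᴳ (gz a b) = gz a (ℤ.- b)

⟪_,_⟫ : GZ → GZ → GZ
⟪ x , y ⟫ = conjᴳ x *ᴳ y

normᴳ : GZ → ℕ
normᴳ (gz a b) = ℤ.∣ a ∣ * ℤ.∣ a ∣ + ℤ.∣ b ∣ * ℤ.∣ b ∣

_≟ᴳ_ : (x y : GZ) → Dec (x ≡ y)
gz a b ≟ᴳ gz c d = map′ (λ (p , q) → cong₂ gz p q) (λ p → cong gre p , cong gim p)
  ((a ℤₚ.≟ c) ×-dec (b ℤₚ.≟ d))

gre-⟪x,x⟫ : ∀ x → gre ⟪ x , x ⟫ ≡ + normᴳ x
gre-⟪x,x⟫ (gz a b) = trans
  (solve 2 (λ a b → (a :* a) :- ((:- b) :* b) := (a :* a) :+ (b :* b)) refl a b)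
  (cong₂ ℤ._+_ (square a) (square b))
  where
  open ℤ-Solver
  square : ∀ a → a ℤ.* a ≡ + (ℤ.∣ a ∣ * ℤ.∣ a ∣)
  square (+ n) = ℤₚ.+◃n≡+n _
  square -[1+ n ] = ℤₚ.+◃n≡+n _

+ᴳ-commutativeMonoid : CommutativeMonoid 0ℓ 0ℓ
+ᴳ-commutativeMonoid = record
  { Carrier = GZ ; _≈_ = _≡_ ; _∙_ = _+ᴳ_ ; ε = 0ᴳ
  ; isCommutativeMonoid = record
    { isMonoid = record
      { isSemigroup = record
        { isMagma = record { isEquivalence = isEquivalence ; ∙-cong = cong₂ _+ᴳ_ }
        ; assoc = λ where (gz a b) (gz c d) (gz e f) → cong₂ gz (ℤₚ.+-assoc a c e) (ℤₚ.+-assoc b d f) }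
      ; identity = (λ where (gz a b) → cong₂ gz (ℤₚ.+-identityˡ a) (ℤₚ.+-identityˡ b))
                 , (λ where (gz a b) → cong₂ gz (ℤₚ.+-identityʳ a) (ℤₚ.+-identityʳ b)) }
    ; comm = λ where (gz a b) (gz c d) → cong₂ gz (ℤₚ.+-comm a c) (ℤₚ.+-comm b d) } }

-- The increasing enumeration of the complement of {r, s}.
skip₂ : ∀ {m} {r s : Fin (suc (suc m))} → r ≢ s → Fin m → Fin (suc (suc m))
skip₂ {r = r} r≢s = punchIn r ∘ punchIn (punchOut r≢s)

skip₂≢ˡ : ∀ {m} {r s : Fin (suc (suc m))} (r≢s : r ≢ s) i → skip₂ r≢s i ≢ r
skip₂≢ˡ {r = r} r≢s i = Finₚ.punchInᵢ≢i r _

skip₂≢ʳ : ∀ {m} {r s : Fin (suc (suc m))} (r≢s : r ≢ s) i → skip₂ r≢s i ≢ s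
skip₂≢ʳ {r = r} r≢s i eq = Finₚ.punchInᵢ≢i (punchOut r≢s) i
  (Finₚ.punchIn-injective r _ _ (trans eq (sym (Finₚ.punchIn-punchOut r≢s))))

skip₂-injective : ∀ {m} {r s : Fin (suc (suc m))} (r≢s : r ≢ s) i j → skip₂ r≢s i ≡ skip₂ r≢s j → i ≡ j
skip₂-injective {r = r} r≢s i j eq = Finₚ.punchIn-injective (punchOut r≢s) _ _ (Finₚ.punchIn-injective r _ _ eq)

module Sum (M : CommutativeMonoid 0ℓ 0ℓ) where
  open CommutativeMonoid M using (_≈_; _∙_; ε; ∙-cong; ∙-congˡ; identityˡ; identityʳ; comm)
    renaming (Carrier to A; refl to ≈-refl; trans to ≈-trans)
  open import Algebra.Properties.CommutativeMonoid.Sum M public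

  sum-≈ε : ∀ {n} (f : Fin n → A) → (∀ k → f k ≈ ε) → sum f ≈ ε
  sum-≈ε {zero} f f≈ε = ≈-refl
  sum-≈ε {suc n} f f≈ε = ≈-trans (∙-cong (f≈ε zero) (sum-≈ε (f ∘ suc) (f≈ε ∘ suc))) (identityˡ ε)

  sum-single : ∀ {n} (f : Fin n → A) r → (∀ k → k ≢ r → f k ≈ ε) → sum f ≈ f r
  sum-single {suc n} f zero f≈ε = ≈-trans (∙-congˡ (sum-≈ε _ (λ k → f≈ε (suc k) λ ()))) (identityʳ _)
  sum-single {suc n} f (suc r) f≈ε =
    ≈-trans (∙-cong (f≈ε zero λ ()) (sum-single (f ∘ suc) r (λ k k≢r → f≈ε (suc k) (k≢r ∘ Finₚ.suc-injective))))
          (identityˡ _)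

  sum-pair : ∀ {n} (f : Fin n → A) r s → r ≢ s → (∀ k → k ≢ r → k ≢ s → f k ≈ ε) → sum f ≈ f r ∙ f s
  sum-pair {suc n} f zero zero r≢s f≈ε = ⊥-elim (r≢s refl)
  sum-pair {suc n} f zero (suc s) r≢s f≈ε =
    ∙-congˡ (sum-single (f ∘ suc) s (λ k k≢s → f≈ε (suc k) (λ ()) (k≢s ∘ Finₚ.suc-injective)))
  sum-pair {suc n} f (suc r) zero r≢s f≈ε =
    ≈-trans (∙-congˡ (sum-single (f ∘ suc) r (λ k k≢r → f≈ε (suc k) (k≢r ∘ Finₚ.suc-injective) (λ ()))))
          (comm _ _)
  sum-pair {suc n} f (suc r) (suc s) r≢s f≈ε =
    ≈-trans (∙-cong (f≈ε zero (λ ()) (λ ()))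
                  (sum-pair (f ∘ suc) r s (r≢s ∘ cong suc)
                     (λ k k≢r k≢s → f≈ε (suc k) (k≢r ∘ Finₚ.suc-injective) (k≢s ∘ Finₚ.suc-injective))))
          (identityˡ _)

  sum-drop : ∀ {n} (f : Fin (suc n) → A) r → f r ≈ ε → sum f ≈ sum (f ∘ punchIn r)
  sum-drop f r fr≈ε = ≈-trans (sum-remove {i = r} f) (≈-trans (∙-cong fr≈ε ≈-refl) (identityˡ _))

  sum-drop₂ : ∀ {m} (f : Fin (suc (suc m)) → A) {r s} (r≢s : r ≢ s) → f r ≈ ε → f s ≈ ε →
              sum f ≈ sum (f ∘ skip₂ r≢s)
  sum-drop₂ f {r} r≢s fr≈ε fs≈ε = ≈-trans (sum-drop f r fr≈ε)
    (sum-drop (f ∘ punchIn r) (punchOut r≢s) (subst (λ x → f x ≈ ε) (sym (Finₚ.punchIn-punchOut r≢s)) fs≈ε))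

module Σℕ = Sum ℕₚ.+-0-commutativeMonoid
module Σℤ = Sum ℤₚ.+-0-commutativeMonoid
module Σᴳ = Sum +ᴳ-commutativeMonoid

sumℕ : ∀ {n} → (Fin n → ℕ) → ℕ
sumℕ = Σℕ.sum

sumᴳ : ∀ {n} → (Fin n → GZ) → GZ
sumᴳ = Σᴳ.sum

foldr-homomorphic : ∀ {A B : Set} {_∙_ : A → A → A} {_◦_ : B → B → B} {ε : A} {ε′ : B} (h : A → B) →
  h ε ≡ ε′ → (∀ x y → h (x ∙ y) ≡ h x ◦ h y) →
  ∀ {n} (f : Fin n → A) → h (Vector.foldr _∙_ ε f) ≡ Vector.foldr _◦_ ε′ (h ∘ f)
foldr-homomorphic h h-ε h-∙ {zero} f = h-ε
foldr-homomorphic {_◦_ = _◦_} h h-ε h-∙ {suc n} f =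
  trans (h-∙ _ _) (cong (h (f zero) ◦_) (foldr-homomorphic {_◦_ = _◦_} h h-ε h-∙ (f ∘ suc)))

gre-sum : ∀ {n} (g : Fin n → GZ) → gre (sumᴳ g) ≡ Σℤ.sum (gre ∘ g)
gre-sum = foldr-homomorphic gre refl λ where (gz a b) (gz c d) → refl

+-sum : ∀ {n} (f : Fin n → ℕ) → + sumℕ f ≡ Σℤ.sum (+_ ∘ f)
+-sum = foldr-homomorphic +_ refl λ _ _ → refl

≤-sum : ∀ {n} (f : Fin n → ℕ) r → f r ≤ sumℕ f
≤-sum {suc n} f r rewrite Σℕ.sum-remove {i = r} f = ℕₚ.m≤m+n (f r) _

+-≤-sum : ∀ {n} (f : Fin n → ℕ) r s → r ≢ s → f r + f s ≤ sumℕ f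
+-≤-sum {suc n} f r s r≢s rewrite Σℕ.sum-remove {i = r} f =
  ℕₚ.+-monoʳ-≤ (f r) (subst (λ x → f x ≤ _) (Finₚ.punchIn-punchOut r≢s)
    (≤-sum (f ∘ punchIn r) (punchOut r≢s)))

+-+-≤-sum : ∀ {n} (f : Fin n → ℕ) r s t → r ≢ s → r ≢ t → s ≢ t → f r + f s + f t ≤ sumℕ f
+-+-≤-sum {suc n} f r s t r≢s r≢t s≢t rewrite Σℕ.sum-remove {i = r} f | ℕₚ.+-assoc (f r) (f s) (f t) =
  ℕₚ.+-monoʳ-≤ (f r)
    (subst₂ (λ x y → f x + f y ≤ _) (Finₚ.punchIn-punchOut r≢s) (Finₚ.punchIn-punchOut r≢t)
      (+-≤-sum (f ∘ punchIn r) (punchOut r≢s) (punchOut r≢t) (s≢t ∘ Finₚ.punchOut-injective r≢s r≢t)))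

positive-term : ∀ {n} (f : Fin n → ℕ) → 0 < sumℕ f → ∃ λ k → 0 < f k
positive-term {suc n} f 0<Σ with f zero in eq
... | suc _ = zero , subst (0 <_) (sym eq) (s≤s z≤n)
... | zero = let k , 0<fk = positive-term (f ∘ suc) 0<Σ in suc k , 0<fk

other-positive-term : ∀ {n} (f : Fin n → ℕ) r → f r < sumℕ f → ∃ λ k → k ≢ r × 0 < f k
other-positive-term {suc n} f r fr<Σ rewrite Σℕ.sum-remove {i = r} f =
  let k , 0<fk = positive-term (f ∘ punchIn r)
                   (ℕₚ.+-cancelˡ-< (f r) 0 _ (subst (_< f r + sumℕ (f ∘ punchIn r)) (sym (ℕₚ.+-identityʳ (f r))) fr<Σ))
  in punchIn r k , Finₚ.punchInᵢ≢i r k , 0<fk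

sum≡term⇒others≡0 : ∀ {n} (f : Fin n → ℕ) r → sumℕ f ≡ f r → ∀ k → k ≢ r → f k ≡ 0
sum≡term⇒others≡0 f r Σ≡fr k k≢r = ℕₚ.n≤0⇒n≡0 (ℕₚ.+-cancelˡ-≤ (f r) (f k) 0
  (subst (f r + f k ≤_) (trans Σ≡fr (sym (ℕₚ.+-identityʳ (f r)))) (+-≤-sum f r k (k≢r ∘ sym))))

sum≡pair⇒others≡0 : ∀ {n} (f : Fin n → ℕ) r s → r ≢ s → sumℕ f ≡ f r + f s →
                    ∀ k → k ≢ r → k ≢ s → f k ≡ 0
sum≡pair⇒others≡0 f r s r≢s Σ≡fr+fs k k≢r k≢s = ℕₚ.n≤0⇒n≡0 (ℕₚ.+-cancelˡ-≤ (f r + f s) (f k) 0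
  (subst (f r + f s + f k ≤_) (trans Σ≡fr+fs (sym (ℕₚ.+-identityʳ _)))
     (+-+-≤-sum f r s k r≢s (k≢r ∘ sym) (k≢s ∘ sym))))

-- Gaussian integers of norm at most 2

data Small : Set where
  0ₛ 1ₛ -1ₛ iₛ -iₛ 1+iₛ 1-iₛ -1+iₛ -1-iₛ : Small

⟦_⟧ : Small → GZ
⟦ 0ₛ ⟧ = gz (+ 0) (+ 0)
⟦ 1ₛ ⟧ = gz (+ 1) (+ 0)
⟦ -1ₛ ⟧ = gz (ℤ.- (+ 1)) (+ 0)
⟦ iₛ ⟧ = gz (+ 0) (+ 1)
⟦ -iₛ ⟧ = gz (+ 0) (ℤ.- (+ 1))
⟦ 1+iₛ ⟧ = gz (+ 1) (+ 1)
⟦ 1-iₛ ⟧ = gz (+ 1) (ℤ.- (+ 1))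
⟦ -1+iₛ ⟧ = gz (ℤ.- (+ 1)) (+ 1)
⟦ -1-iₛ ⟧ = gz (ℤ.- (+ 1)) (ℤ.- (+ 1))

norm : Small → ℕ
norm e = normᴳ ⟦ e ⟧

⟪_,_⟫ₛ : Small → Small → GZ
⟪ e , f ⟫ₛ = ⟪ ⟦ e ⟧ , ⟦ f ⟧ ⟫

fromFin : Fin 9 → Small
fromFin zero = 0ₛ
fromFin (suc zero) = 1ₛ
fromFin (suc (suc zero)) = -1ₛ
fromFin (suc (suc (suc zero))) = iₛ
fromFin (suc (suc (suc (suc zero)))) = -iₛ
fromFin (suc (suc (suc (suc (suc zero))))) = 1+iₛ
fromFin (suc (suc (suc (suc (suc (suc zero)))))) = 1-iₛ
fromFin (suc (suc (suc (suc (suc (suc (suc zero))))))) = -1+iₛ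
fromFin (suc (suc (suc (suc (suc (suc (suc (suc zero)))))))) = -1-iₛ

toFin : Small → Fin 9
toFin 0ₛ = zero
toFin 1ₛ = suc zero
toFin -1ₛ = suc (suc zero)
toFin iₛ = suc (suc (suc zero))
toFin -iₛ = suc (suc (suc (suc zero)))
toFin 1+iₛ = suc (suc (suc (suc (suc zero))))
toFin 1-iₛ = suc (suc (suc (suc (suc (suc zero)))))
toFin -1+iₛ = suc (suc (suc (suc (suc (suc (suc zero))))))
toFin -1-iₛ = suc (suc (suc (suc (suc (suc (suc (suc zero)))))))

fromFin-toFin : ∀ e → fromFin (toFin e) ≡ e
fromFin-toFin 0ₛ = refl
fromFin-toFin 1ₛ = refl
fromFin-toFin -1ₛ = refl
fromFin-toFin iₛ = refl
fromFin-toFin -iₛ = refl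
fromFin-toFin 1+iₛ = refl
fromFin-toFin 1-iₛ = refl
fromFin-toFin -1+iₛ = refl
fromFin-toFin -1-iₛ = refl

_≟ₛ_ : (e f : Small) → Dec (e ≡ f)
e ≟ₛ f = map′ (λ p → trans (sym (fromFin-toFin e)) (trans (cong fromFin p) (fromFin-toFin f)))
              (cong toFin) (toFin e Finₚ.≟ toFin f)

all? : {P : Small → Set} → (∀ e → Dec (P e)) → Dec (∀ e → P e)
all? {P} P? = map′ (λ ∀P e → subst P (fromFin-toFin e) (∀P (toFin e))) (λ ∀P → ∀P ∘ fromFin)
                   (Finₚ.all? (P? ∘ fromFin))

IsUnit : Small → Set
IsUnit e = norm e ≡ 1

isUnit? : ∀ e → Dec (IsUnit e)
isUnit? e = norm e ℕₚ.≟ 1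

⟪⟫ₛ-zeroˡ : ∀ e → ⟪ 0ₛ , e ⟫ₛ ≡ 0ᴳ
⟪⟫ₛ-zeroˡ = toWitness {a? = all? λ e → ⟪ 0ₛ , e ⟫ₛ ≟ᴳ 0ᴳ} tt

⟪⟫ₛ≡0⇒zero : ∀ e a → e ≢ 0ₛ → ⟪ e , a ⟫ₛ ≡ 0ᴳ → a ≡ 0ₛ
⟪⟫ₛ≡0⇒zero = toWitness {a? = all? λ e → all? λ a →
  ¬? (e ≟ₛ 0ₛ) →-dec (⟪ e , a ⟫ₛ ≟ᴳ 0ᴳ) →-dec (a ≟ₛ 0ₛ)} tt

norm≡0⇒0ₛ : ∀ e → norm e ≡ 0 → e ≡ 0ₛ
norm≡0⇒0ₛ = toWitness {a? = all? λ e → (norm e ℕₚ.≟ 0) →-dec (e ≟ₛ 0ₛ)} tt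

nonunit⇒norm≡2 : ∀ e → ¬ IsUnit e → 0 < norm e → norm e ≡ 2
nonunit⇒norm≡2 = toWitness {a? = all? λ e → ¬? (isUnit? e) →-dec (0 ℕₚ.<? norm e) →-dec (norm e ℕₚ.≟ 2)} tt

norm+norm≤2⇒unit : ∀ e → e ≢ 0ₛ → norm e + norm e ≤ 2 → IsUnit e
norm+norm≤2⇒unit = toWitness {a? = all? λ e →
  ¬? (e ≟ₛ 0ₛ) →-dec (norm e + norm e ℕₚ.≤? 2) →-dec isUnit? e} tt

⟦⟧≡1+i⇒1+iₛ : ∀ e → ⟦ e ⟧ ≡ 1+i → e ≡ 1+iₛ
⟦⟧≡1+i⇒1+iₛ = toWitness {a? = all? λ e → (⟦ e ⟧ ≟ᴳ 1+i) →-dec (e ≟ₛ 1+iₛ)} tt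

unit-orthogonal⇒same-norm : ∀ u w a b → IsUnit u → IsUnit w → a ≢ 0ₛ →
  ⟪ u , a ⟫ₛ +ᴳ ⟪ w , b ⟫ₛ ≡ 0ᴳ → norm b ≡ norm a
unit-orthogonal⇒same-norm = toWitness {a? = all? λ u → all? λ w → all? λ a → all? λ b →
  isUnit? u →-dec isUnit? w →-dec ¬? (a ≟ₛ 0ₛ) →-dec ((⟪ u , a ⟫ₛ +ᴳ ⟪ w , b ⟫ₛ) ≟ᴳ 0ᴳ)
  →-dec (norm b ℕₚ.≟ norm a)} tt

orthogonal-to-unit-frame⇒zero : ∀ u w a b → IsUnit u → IsUnit w → IsUnit a → IsUnit b →
  ⟪ u , a ⟫ₛ +ᴳ ⟪ w , b ⟫ₛ ≡ 0ᴳ →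
  ∀ c d → ⟪ u , c ⟫ₛ +ᴳ ⟪ w , d ⟫ₛ ≡ 0ᴳ → ⟪ a , c ⟫ₛ +ᴳ ⟪ b , d ⟫ₛ ≡ 0ᴳ → c ≡ 0ₛ × d ≡ 0ₛ
orthogonal-to-unit-frame⇒zero = toWitness {a? = all? λ u → all? λ w → all? λ a → all? λ b →
  isUnit? u →-dec isUnit? w →-dec isUnit? a →-dec isUnit? b →-dec
  ((⟪ u , a ⟫ₛ +ᴳ ⟪ w , b ⟫ₛ) ≟ᴳ 0ᴳ) →-dec all? λ c → all? λ d →
  ((⟪ u , c ⟫ₛ +ᴳ ⟪ w , d ⟫ₛ) ≟ᴳ 0ᴳ) →-dec ((⟪ a , c ⟫ₛ +ᴳ ⟪ b , d ⟫ₛ) ≟ᴳ 0ᴳ) →-dec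
  ((c ≟ₛ 0ₛ) ×-dec (d ≟ₛ 0ₛ))} tt

unit-frame-with-row-sums : ∀ u w a b → IsUnit u → IsUnit w → IsUnit a → IsUnit b →
  ⟪ u , a ⟫ₛ +ᴳ ⟪ w , b ⟫ₛ ≡ 0ᴳ → ⟦ u ⟧ +ᴳ ⟦ a ⟧ ≡ 1+i → ⟦ w ⟧ +ᴳ ⟦ b ⟧ ≡ 1+i →
  (u ≡ 1ₛ × w ≡ iₛ × a ≡ iₛ × b ≡ 1ₛ) ⊎ (u ≡ iₛ × w ≡ 1ₛ × a ≡ 1ₛ × b ≡ iₛ)
unit-frame-with-row-sums = toWitness {a? = all? λ u → all? λ w → all? λ a → all? λ b →
  isUnit? u →-dec isUnit? w →-dec isUnit? a →-dec isUnit? b →-dec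
  ((⟪ u , a ⟫ₛ +ᴳ ⟪ w , b ⟫ₛ) ≟ᴳ 0ᴳ) →-dec ((⟦ u ⟧ +ᴳ ⟦ a ⟧) ≟ᴳ 1+i) →-dec ((⟦ w ⟧ +ᴳ ⟦ b ⟧) ≟ᴳ 1+i) →-dec
  (((u ≟ₛ 1ₛ) ×-dec (w ≟ₛ iₛ) ×-dec (a ≟ₛ iₛ) ×-dec (b ≟ₛ 1ₛ)) ⊎-dec
   ((u ≟ₛ iₛ) ×-dec (w ≟ₛ 1ₛ) ×-dec (a ≟ₛ 1ₛ) ×-dec (b ≟ₛ iₛ)))} tt

square≰2 : ∀ n → ¬ (suc (suc n) * suc (suc n) ≤ 2)
square≰2 n 4+≤2 with ℕₚ.≤-trans (ℕₚ.*-mono-≤ {2} {suc (suc n)} {2} {suc (suc n)} (s≤s (s≤s z≤n)) (s≤s (s≤s z≤n))) 4+≤2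
... | s≤s (s≤s ())

normᴳ≤2⇒small : ∀ g → normᴳ g ≤ 2 → Σ Small λ e → ⟦ e ⟧ ≡ g
normᴳ≤2⇒small (gz (+ 0) (+ 0)) _ = 0ₛ , refl
normᴳ≤2⇒small (gz (+ 1) (+ 0)) _ = 1ₛ , refl
normᴳ≤2⇒small (gz -[1+ 0 ] (+ 0)) _ = -1ₛ , refl
normᴳ≤2⇒small (gz (+ 0) (+ 1)) _ = iₛ , refl
normᴳ≤2⇒small (gz (+ 0) -[1+ 0 ]) _ = -iₛ , refl
normᴳ≤2⇒small (gz (+ 1) (+ 1)) _ = 1+iₛ , refl
normᴳ≤2⇒small (gz (+ 1) -[1+ 0 ]) _ = 1-iₛ , refl
normᴳ≤2⇒small (gz -[1+ 0 ] (+ 1)) _ = -1+iₛ , refl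
normᴳ≤2⇒small (gz -[1+ 0 ] -[1+ 0 ]) _ = -1-iₛ , refl
normᴳ≤2⇒small (gz (+ suc (suc n)) b) h = ⊥-elim (square≰2 n (ℕₚ.≤-trans (ℕₚ.m≤m+n _ _) h))
normᴳ≤2⇒small (gz -[1+ suc n ] b) h = ⊥-elim (square≰2 n (ℕₚ.≤-trans (ℕₚ.m≤m+n _ _) h))
normᴳ≤2⇒small (gz (+ 0) (+ suc (suc n))) h = ⊥-elim (square≰2 n h)
normᴳ≤2⇒small (gz (+ 0) -[1+ suc n ]) h = ⊥-elim (square≰2 n h)
normᴳ≤2⇒small (gz (+ 1) (+ suc (suc n))) h = ⊥-elim (square≰2 n (ℕₚ.≤-trans (ℕₚ.m≤n+m _ 1) h))
normᴳ≤2⇒small (gz (+ 1) -[1+ suc n ]) h = ⊥-elim (square≰2 n (ℕₚ.≤-trans (ℕₚ.m≤n+m _ 1) h))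
normᴳ≤2⇒small (gz -[1+ 0 ] (+ suc (suc n))) h = ⊥-elim (square≰2 n (ℕₚ.≤-trans (ℕₚ.m≤n+m _ 1) h))
normᴳ≤2⇒small (gz -[1+ 0 ] -[1+ suc n ]) h = ⊥-elim (square≰2 n (ℕₚ.≤-trans (ℕₚ.m≤n+m _ 1) h))

-- Admissible matrices and their block normal form

MatS : ℕ → Set
MatS n = Fin n → Fin n → Small

-- The properties of (1 + i) U used in the combinatorial argument.
record Admissible {n} (W : MatS n) : Set where
  field
    column-norm : ∀ j → sumℕ (λ k → norm (W k j)) ≡ 2
    columns-orthogonal : ∀ j j' → j ≢ j' → sumᴳ (λ k → ⟪ W k j , W k j' ⟫ₛ) ≡ 0ᴳ
    row-sum : ∀ r → sumᴳ (λ j → ⟦ W r j ⟧) ≡ 1+i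

diagₛ : ∀ {n} → MatS n
diagₛ i j with i Finₚ.≟ j
... | yes _ = 1+iₛ
... | no _ = 0ₛ

diagₛ-suc : ∀ {n} (i j : Fin n) → diagₛ (suc i) (suc j) ≡ diagₛ i j
diagₛ-suc i j with i Finₚ.≟ j
... | yes refl = refl
... | no _ = refl

-- (1 + i) U_{k,s}
blocksₛ : (k s : ℕ) → MatS (k * 2 + s)
blocksₛ zero s = diagₛ
blocksₛ (suc k) s zero zero = 1ₛ
blocksₛ (suc k) s zero (suc zero) = iₛ
blocksₛ (suc k) s (suc zero) zero = iₛ
blocksₛ (suc k) s (suc zero) (suc zero) = 1ₛ
blocksₛ (suc k) s zero (suc (suc j)) = 0ₛ
blocksₛ (suc k) s (suc zero) (suc (suc j)) = 0ₛ
blocksₛ (suc k) s (suc (suc i)) zero = 0ₛ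
blocksₛ (suc k) s (suc (suc i)) (suc zero) = 0ₛ
blocksₛ (suc k) s (suc (suc i)) (suc (suc j)) = blocksₛ k s i j

castMatₛ : ∀ {m n} → m ≡ n → MatS m → MatS n
castMatₛ refl W = W

record BlockForm {n} (W : MatS n) : Set where
  field
    k s : ℕ
    order : k * 2 + s ≡ n
    σ ρ : Permutation′ n
    shape : ∀ i j → W (σ ⟨$⟩ʳ i) (ρ ⟨$⟩ʳ j) ≡ castMatₛ order (blocksₛ k s) i j

castMatₛ-diagₛ : ∀ {s n} (order : 0 * 2 + s ≡ n) i j →
  castMatₛ order (blocksₛ 0 s) i j ≡ 0ₛ ⊎ castMatₛ order (blocksₛ 0 s) i j ≡ 1+iₛ
castMatₛ-diagₛ refl i j with i Finₚ.≟ j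
... | yes _ = inj₂ refl
... | no _ = inj₁ refl

⟦⟧-0ₛ : ∀ {e} → e ≡ 0ₛ → ⟦ e ⟧ ≡ 0ᴳ
⟦⟧-0ₛ refl = refl

⟪⟫ₛ-0ₛˡ : ∀ {e} f → e ≡ 0ₛ → ⟪ e , f ⟫ₛ ≡ 0ᴳ
⟪⟫ₛ-0ₛˡ f refl = ⟪⟫ₛ-zeroˡ f

norm-0ₛ : ∀ {e} → e ≡ 0ₛ → norm e ≡ 0
norm-0ₛ refl = refl

Admissible-minor : ∀ {n} {W : MatS (suc n)} → Admissible W → ∀ r c →
  (∀ j → j ≢ c → W r j ≡ 0ₛ) → (∀ k → k ≢ r → W k c ≡ 0ₛ) →
  Admissible (λ i j → W (punchIn r i) (punchIn c j))
Admissible-minor {W = W} adm r c row-r col-c = record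
  { column-norm = λ j → trans (sym (Σℕ.sum-drop (λ k → norm (W k (punchIn c j))) r (norm-0ₛ (row-r′ j)))) (column-norm (punchIn c j))
  ; columns-orthogonal = λ j j' j≢j' →
      trans (sym (Σᴳ.sum-drop (λ k → ⟪ W k (punchIn c j) , W k (punchIn c j') ⟫ₛ) r (⟪⟫ₛ-0ₛˡ (W r (punchIn c j')) (row-r′ j))))
            (columns-orthogonal _ _ (j≢j' ∘ Finₚ.punchIn-injective c j j'))
  ; row-sum = λ i → trans (sym (Σᴳ.sum-drop (λ j → ⟦ W (punchIn r i) j ⟧) c (⟦⟧-0ₛ (col-c _ (Finₚ.punchInᵢ≢i r i))))) (row-sum (punchIn r i))
  }
  where
  open Admissible adm
  row-r′ : ∀ j → W r (punchIn c j) ≡ 0ₛ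
  row-r′ j = row-r _ (Finₚ.punchInᵢ≢i c j)

Admissible-minor₂ : ∀ {m} {W : MatS (suc (suc m))} → Admissible W →
  ∀ {r s c d} (r≢s : r ≢ s) (c≢d : c ≢ d) →
  (∀ j → j ≢ c → j ≢ d → W r j ≡ 0ₛ × W s j ≡ 0ₛ) → (∀ k → k ≢ r → k ≢ s → W k c ≡ 0ₛ × W k d ≡ 0ₛ) →
  Admissible (λ i j → W (skip₂ r≢s i) (skip₂ c≢d j))
Admissible-minor₂ {W = W} adm {r} {s} {c} {d} r≢s c≢d rows-rs cols-cd = record
  { column-norm = λ j → trans
      (sym (Σℕ.sum-drop₂ (λ k → norm (W k (C j))) r≢s (norm-0ₛ (proj₁ (rows j))) (norm-0ₛ (proj₂ (rows j)))))
      (column-norm (C j))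
  ; columns-orthogonal = λ j j' j≢j' → trans
      (sym (Σᴳ.sum-drop₂ (λ k → ⟪ W k (C j) , W k (C j') ⟫ₛ) r≢s
        (⟪⟫ₛ-0ₛˡ (W r (C j')) (proj₁ (rows j))) (⟪⟫ₛ-0ₛˡ (W s (C j')) (proj₂ (rows j)))))
      (columns-orthogonal _ _ (j≢j' ∘ skip₂-injective c≢d j j'))
  ; row-sum = λ i → trans
      (sym (Σᴳ.sum-drop₂ (λ j → ⟦ W (R i) j ⟧) c≢d (⟦⟧-0ₛ (proj₁ (cols i))) (⟦⟧-0ₛ (proj₂ (cols i)))))
      (row-sum (R i))
  }
  where
  open Admissible adm
  R = skip₂ r≢s
  C = skip₂ c≢d
  rows : ∀ j → W r (C j) ≡ 0ₛ × W s (C j) ≡ 0ₛ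
  rows j = rows-rs (C j) (skip₂≢ˡ c≢d j) (skip₂≢ʳ c≢d j)
  cols : ∀ i → W (R i) c ≡ 0ₛ × W (R i) d ≡ 0ₛ
  cols i = cols-cd (R i) (skip₂≢ˡ r≢s i) (skip₂≢ʳ r≢s i)

module _ {n} {W : MatS n} (adm : Admissible W) where
  open Admissible adm

  column-norm2⇒isolated : ∀ r c → norm (W r c) ≡ 2 → ∀ k → k ≢ r → W k c ≡ 0ₛ
  column-norm2⇒isolated r c nr k k≢r =
    norm≡0⇒0ₛ _ (sum≡term⇒others≡0 (λ k → norm (W k c)) r (trans (column-norm c) (sym nr)) k k≢r)

  column-isolated⇒row-isolated : ∀ r c → W r c ≢ 0ₛ → (∀ k → k ≢ r → W k c ≡ 0ₛ) →
                                 ∀ j → j ≢ c → W r j ≡ 0ₛ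
  column-isolated⇒row-isolated r c Wrc≢0 col-c j j≢c = ⟪⟫ₛ≡0⇒zero _ _ Wrc≢0 (begin
    ⟪ W r c , W r j ⟫ₛ                  ≡⟨ Σᴳ.sum-single (λ k → ⟪ W k c , W k j ⟫ₛ) r
                                             (λ k k≢r → ⟪⟫ₛ-0ₛˡ (W k j) (col-c k k≢r)) ⟨
    sumᴳ (λ k → ⟪ W k c , W k j ⟫ₛ)     ≡⟨ columns-orthogonal c j (j≢c ∘ sym) ⟩
    0ᴳ                                  ∎)
    where open ≡-Reasoning

  row-isolated⇒1+iₛ : ∀ r c → (∀ j → j ≢ c → W r j ≡ 0ₛ) → W r c ≡ 1+iₛ
  row-isolated⇒1+iₛ r c row-r = ⟦⟧≡1+i⇒1+iₛ _
    (trans (sym (Σᴳ.sum-single (λ j → ⟦ W r j ⟧) c (λ j j≢c → ⟦⟧-0ₛ (row-r j j≢c)))) (row-sum r))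

  units⇒column-isolated : ∀ {r s} c → r ≢ s → IsUnit (W r c) → IsUnit (W s c) →
                          ∀ k → k ≢ r → k ≢ s → W k c ≡ 0ₛ
  units⇒column-isolated {r} {s} c r≢s unit-r unit-s k k≢r k≢s = norm≡0⇒0ₛ _
    (sum≡pair⇒others≡0 (λ k → norm (W k c)) r s r≢s
      (trans (column-norm c) (sym (cong₂ _+_ unit-r unit-s))) k k≢r k≢s)

  unit-partner : ∀ r c → IsUnit (W r c) → ∃ λ s → r ≢ s × IsUnit (W s c)
  unit-partner r c unit-r = s , s≢r ∘ sym , unit-s
    where
    f : Fin n → ℕ
    f k = norm (W k c)
    other = other-positive-term f r (subst₂ _<_ (sym unit-r) (sym (column-norm c)) (s≤s (s≤s z≤n)))
    s = proj₁ other
    s≢r = proj₁ (proj₂ other)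
    unit-s : f s ≡ 1
    unit-s = ℕₚ.≤-antisym
      (ℕₚ.+-cancelˡ-≤ 1 (f s) 1 (subst₂ (λ a b → a + f s ≤ b) unit-r (column-norm c) (+-≤-sum f r s (s≢r ∘ sym))))
      (proj₂ (proj₂ other))

  column-pair-orthogonal : ∀ {r s c} c' → r ≢ s → c ≢ c' → (∀ k → k ≢ r → k ≢ s → W k c ≡ 0ₛ) →
                           ⟪ W r c , W r c' ⟫ₛ +ᴳ ⟪ W s c , W s c' ⟫ₛ ≡ 0ᴳ
  column-pair-orthogonal {r} {s} {c} c' r≢s c≢c' col-c = trans
    (sym (Σᴳ.sum-pair (λ k → ⟪ W k c , W k c' ⟫ₛ) r s r≢s (λ k k≢r k≢s → ⟪⟫ₛ-0ₛˡ (W k c') (col-c k k≢r k≢s))))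
    (columns-orthogonal c c' c≢c')

  row-pair-sum : ∀ r {c d} → c ≢ d → (∀ j → j ≢ c → j ≢ d → W r j ≡ 0ₛ) → ⟦ W r c ⟧ +ᴳ ⟦ W r d ⟧ ≡ 1+i
  row-pair-sum r {c} {d} c≢d row-r = trans
    (sym (Σᴳ.sum-pair (λ j → ⟦ W r j ⟧) c d c≢d (λ j j≢c j≢d → ⟦⟧-0ₛ (row-r j j≢c j≢d)))) (row-sum r)

  unit-row-second-entry : ∀ r c → IsUnit (W r c) → ∃ λ d → c ≢ d × W r d ≢ 0ₛ
  unit-row-second-entry r c unit with Finₚ.any? (λ d → ¬? (c Finₚ.≟ d) ×-dec ¬? (W r d ≟ₛ 0ₛ))
  ... | yes (d , c≢d , Wrd≢0) = d , c≢d , Wrd≢0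
  ... | no none = contradiction (trans (sym norm≡2) unit) λ ()
    where
    norm≡2 : norm (W r c) ≡ 2
    norm≡2 = cong norm (row-isolated⇒1+iₛ r c λ d d≢c → decidable-stable (W r d ≟ₛ 0ₛ)
               (λ Wrd≢0 → none (d , d≢c ∘ sym , Wrd≢0)))

unitless⇒diagonal : ∀ n (W : MatS n) → Admissible W → (∀ r j → ¬ IsUnit (W r j)) →
  Σ (Permutation′ n) λ σ → Σ (Permutation′ n) λ ρ → ∀ i j → W (σ ⟨$⟩ʳ i) (ρ ⟨$⟩ʳ j) ≡ diagₛ i j
unitless⇒diagonal zero W adm no-unit = Perm.id , Perm.id , λ ()
unitless⇒diagonal (suc m) W adm no-unit = σ , ρ , shape
  where
  open Admissible adm
  nonzero-entry = positive-term (λ k → norm (W k zero)) (subst (0 <_) (sym (column-norm zero)) (s≤s z≤n))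
  r = proj₁ nonzero-entry
  norm≡2 : norm (W r zero) ≡ 2
  norm≡2 = nonunit⇒norm≡2 (W r zero) (no-unit r zero) (proj₂ nonzero-entry)
  col-0 = column-norm2⇒isolated adm r zero norm≡2
  row-r = column-isolated⇒row-isolated adm r zero
            (λ Wr0≡0 → ℕₚ.0≢1+n (trans (sym (norm-0ₛ Wr0≡0)) norm≡2)) col-0
  minor = unitless⇒diagonal m (λ i j → W (punchIn r i) (suc j))
            (Admissible-minor adm r zero row-r col-0) (λ i j → no-unit (punchIn r i) (suc j))
  σ′ = proj₁ minor
  ρ′ = proj₁ (proj₂ minor)
  σ ρ : Permutation′ (suc m)
  σ = insert zero r σ′
  ρ = insert zero zero ρ′
  shape : ∀ i j → W (σ ⟨$⟩ʳ i) (ρ ⟨$⟩ʳ j) ≡ diagₛ i j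
  shape zero zero = row-isolated⇒1+iₛ adm r zero row-r
  shape zero (suc j) = trans (cong (W r) (insert-punchIn zero zero ρ′ j)) (row-r _ λ ())
  shape (suc i) zero = trans (cong (λ x → W x zero) (insert-punchIn zero r σ′ i)) (col-0 _ (Finₚ.punchInᵢ≢i r _))
  shape (suc i) (suc j) = trans (cong₂ W (insert-punchIn zero r σ′ i) (insert-punchIn zero zero ρ′ j))
    (trans (proj₂ (proj₂ minor) i j) (sym (diagₛ-suc i j)))

record UnitBlock {n} (W : MatS n) : Set where
  field
    {r s c d} : Fin n
    r≢s : r ≢ s
    c≢d : c ≢ d
    Wrc≡1 : W r c ≡ 1ₛ
    Wrd≡i : W r d ≡ iₛ
    Wsc≡i : W s c ≡ iₛ
    Wsd≡1 : W s d ≡ 1ₛ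
    rows-isolated : ∀ j → j ≢ c → j ≢ d → W r j ≡ 0ₛ × W s j ≡ 0ₛ
    columns-isolated : ∀ k → k ≢ r → k ≢ s → W k c ≡ 0ₛ × W k d ≡ 0ₛ

unit-entry⇒UnitBlock : ∀ {n} {W : MatS n} → Admissible W → ∀ r c → IsUnit (W r c) → UnitBlock W
unit-entry⇒UnitBlock {W = W} adm r c unit-u with unit-partner adm r c unit-u | unit-row-second-entry adm r c unit-u
... | s , r≢s , unit-w | d , c≢d , a≢0 = block (unit-frame-with-row-sums u w a b unit-u unit-w unit-a unit-b
        (orth-c d c≢d) (row-pair-sum adm r c≢d (λ j j≢c j≢d → proj₁ (rows j j≢c j≢d)))
        (row-pair-sum adm s c≢d (λ j j≢c j≢d → proj₂ (rows j j≢c j≢d))))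
  where
  open Admissible adm
  u = W r c
  w = W s c
  a = W r d
  b = W s d
  col-c = units⇒column-isolated adm c r≢s unit-u unit-w
  orth-c : ∀ j → c ≢ j → ⟪ u , W r j ⟫ₛ +ᴳ ⟪ w , W s j ⟫ₛ ≡ 0ᴳ
  orth-c j c≢j = column-pair-orthogonal adm j r≢s c≢j col-c
  norm-b≡norm-a : norm b ≡ norm a
  norm-b≡norm-a = unit-orthogonal⇒same-norm u w a b unit-u unit-w a≢0 (orth-c d c≢d)
  unit-a : IsUnit a
  unit-a = norm+norm≤2⇒unit a a≢0 (subst₂ (λ x y → norm a + x ≤ y) norm-b≡norm-a (column-norm d)
             (+-≤-sum (λ k → norm (W k d)) r s r≢s))
  unit-b : IsUnit b
  unit-b = trans norm-b≡norm-a unit-a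
  col-d = units⇒column-isolated adm d r≢s unit-a unit-b
  rows : ∀ j → j ≢ c → j ≢ d → W r j ≡ 0ₛ × W s j ≡ 0ₛ
  rows j j≢c j≢d = orthogonal-to-unit-frame⇒zero u w a b unit-u unit-w unit-a unit-b (orth-c d c≢d)
    (W r j) (W s j) (orth-c j (j≢c ∘ sym)) (column-pair-orthogonal adm j r≢s (j≢d ∘ sym) col-d)
  block : (u ≡ 1ₛ × w ≡ iₛ × a ≡ iₛ × b ≡ 1ₛ) ⊎ (u ≡ iₛ × w ≡ 1ₛ × a ≡ 1ₛ × b ≡ iₛ) → UnitBlock W
  block (inj₁ (u≡1 , w≡i , a≡i , b≡1)) = record
    { r≢s = r≢s ; c≢d = c≢d ; Wrc≡1 = u≡1 ; Wrd≡i = a≡i ; Wsc≡i = w≡i ; Wsd≡1 = b≡1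
    ; rows-isolated = rows
    ; columns-isolated = λ k k≢r k≢s → col-c k k≢r k≢s , col-d k k≢r k≢s }
  block (inj₂ (u≡i , w≡1 , a≡1 , b≡i)) = record
    { r≢s = r≢s ; c≢d = c≢d ∘ sym ; Wrc≡1 = a≡1 ; Wrd≡i = u≡i ; Wsc≡i = b≡i ; Wsd≡1 = w≡1
    ; rows-isolated = λ j j≢d j≢c → rows j j≢c j≢d
    ; columns-isolated = λ k k≢r k≢s → col-d k k≢r k≢s , col-c k k≢r k≢s }

UnitBlock-minor : ∀ {m} {W : MatS (suc (suc m))} → UnitBlock W → MatS m
UnitBlock-minor {W = W} B i j = W (skip₂ r≢s i) (skip₂ c≢d j)
  where open UnitBlock B

UnitBlock-minor-admissible : ∀ {m} {W : MatS (suc (suc m))} → Admissible W → (B : UnitBlock W) →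
                             Admissible (UnitBlock-minor B)
UnitBlock-minor-admissible adm B = Admissible-minor₂ adm r≢s c≢d rows-isolated columns-isolated
  where open UnitBlock B

insert₂ : ∀ {m} {r s : Fin (suc (suc m))} → r ≢ s → Permutation′ m → Permutation′ (suc (suc m))
insert₂ {r = r} r≢s π = insert zero r (insert zero (punchOut r≢s) π)

insert₂-1 : ∀ {m} {r s : Fin (suc (suc m))} (r≢s : r ≢ s) π → insert₂ r≢s π ⟨$⟩ʳ suc zero ≡ s
insert₂-1 {r = r} r≢s π = trans (insert-punchIn zero r (insert zero (punchOut r≢s) π) zero) (Finₚ.punchIn-punchOut r≢s)

insert₂-suc-suc : ∀ {m} {r s : Fin (suc (suc m))} (r≢s : r ≢ s) π i →
                  insert₂ r≢s π ⟨$⟩ʳ suc (suc i) ≡ skip₂ r≢s (π ⟨$⟩ʳ i)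
insert₂-suc-suc {r = r} r≢s π i =
  trans (insert-punchIn zero r (insert zero (punchOut r≢s) π) (suc i)) (cong (punchIn r) (insert-punchIn zero (punchOut r≢s) π i))

castMatₛ-blocksₛ-suc : ∀ {k s m} (order : k * 2 + s ≡ m) (M : MatS (suc (suc m))) →
  M zero zero ≡ 1ₛ → M zero (suc zero) ≡ iₛ → M (suc zero) zero ≡ iₛ → M (suc zero) (suc zero) ≡ 1ₛ →
  (∀ j → M zero (suc (suc j)) ≡ 0ₛ) → (∀ j → M (suc zero) (suc (suc j)) ≡ 0ₛ) →
  (∀ i → M (suc (suc i)) zero ≡ 0ₛ) → (∀ i → M (suc (suc i)) (suc zero) ≡ 0ₛ) →
  (∀ i j → M (suc (suc i)) (suc (suc j)) ≡ castMatₛ order (blocksₛ k s) i j) →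
  ∀ i j → M i j ≡ castMatₛ (cong (λ x → 2 + x) order) (blocksₛ (suc k) s) i j
castMatₛ-blocksₛ-suc {k} {s} refl M m00 m01 m10 m11 r0 r1 c0 c1 rest = go
  where
  go : ∀ i j → M i j ≡ blocksₛ (suc k) s i j
  go zero zero = m00
  go zero (suc zero) = m01
  go (suc zero) zero = m10
  go (suc zero) (suc zero) = m11
  go zero (suc (suc j)) = r0 j
  go (suc zero) (suc (suc j)) = r1 j
  go (suc (suc i)) zero = c0 i
  go (suc (suc i)) (suc zero) = c1 i
  go (suc (suc i)) (suc (suc j)) = rest i j

extend-BlockForm : ∀ {m} {W : MatS (suc (suc m))} (B : UnitBlock W) → BlockForm (UnitBlock-minor B) → BlockForm W
extend-BlockForm {m} {W} B minor = record
  { k = suc k ; s = s′ ; order = cong (λ x → 2 + x) order ; σ = σ ; ρ = ρ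
  ; shape = castMatₛ-blocksₛ-suc {k} {s′} order (λ i j → W (σ ⟨$⟩ʳ i) (ρ ⟨$⟩ʳ j))
      Wrc≡1 (subst (λ x → W r x ≡ iₛ) (sym ρ-1) Wrd≡i)
      (subst (λ x → W x c ≡ iₛ) (sym σ-1) Wsc≡i) (subst₂ (λ x y → W x y ≡ 1ₛ) (sym σ-1) (sym ρ-1) Wsd≡1)
      (λ j → trans (cong (W r) (ρ-2 j)) (proj₁ (rows j)))
      (λ j → trans (cong₂ W σ-1 (ρ-2 j)) (proj₂ (rows j)))
      (λ i → trans (cong (λ x → W x c) (σ-2 i)) (proj₁ (cols i)))
      (λ i → trans (cong₂ W (σ-2 i) ρ-1) (proj₂ (cols i)))
      (λ i j → trans (cong₂ W (σ-2 i) (ρ-2 j)) (shape i j))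
  }
  where
  open UnitBlock B
  open BlockForm minor renaming (s to s′; σ to σ′; ρ to ρ′)
  σ ρ : Permutation′ (suc (suc m))
  σ = insert₂ r≢s σ′
  ρ = insert₂ c≢d ρ′
  σ-1 = insert₂-1 r≢s σ′
  ρ-1 = insert₂-1 c≢d ρ′
  σ-2 = insert₂-suc-suc r≢s σ′
  ρ-2 = insert₂-suc-suc c≢d ρ′
  rows : ∀ j → W r (skip₂ c≢d (ρ′ ⟨$⟩ʳ j)) ≡ 0ₛ × W s (skip₂ c≢d (ρ′ ⟨$⟩ʳ j)) ≡ 0ₛ
  rows j = rows-isolated _ (skip₂≢ˡ c≢d _) (skip₂≢ʳ c≢d _)
  cols : ∀ i → W (skip₂ r≢s (σ′ ⟨$⟩ʳ i)) c ≡ 0ₛ × W (skip₂ r≢s (σ′ ⟨$⟩ʳ i)) d ≡ 0ₛ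
  cols i = columns-isolated _ (skip₂≢ˡ r≢s _) (skip₂≢ʳ r≢s _)

blockForm : ∀ n (W : MatS n) → Admissible W → BlockForm W
blockForm n W adm with Finₚ.any? (λ c → Finₚ.any? (λ r → isUnit? (W r c)))
... | no no-unit = record
  { k = 0 ; s = n ; order = refl ; σ = proj₁ diagonal ; ρ = proj₁ (proj₂ diagonal) ; shape = proj₂ (proj₂ diagonal) }
  where diagonal = unitless⇒diagonal n W adm (λ r c unit → no-unit (c , r , unit))
blockForm (suc zero) W adm | yes (c , r , unit) = ⊥-elim (UnitBlock.r≢s B (Fin1-≡ _ _))
  where
  B = unit-entry⇒UnitBlock adm r c unit
  Fin1-≡ : (x y : Fin 1) → x ≡ y
  Fin1-≡ zero zero = refl
blockForm (suc (suc m)) W adm | yes (c , r , unit) =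
  extend-BlockForm B (blockForm m (UnitBlock-minor B) (UnitBlock-minor-admissible adm B))
  where B = unit-entry⇒UnitBlock adm r c unit

ι : ℤ → ℚ
ι z = z / 1

ι≃mkℚᵘ : ∀ z → ℚ.toℚᵘ (ι z) ℚᵘ.≃ mkℚᵘ z 0
ι≃mkℚᵘ z = ℚₚ.toℚᵘ-fromℚᵘ (mkℚᵘ z 0)

ι-homo-+ : ∀ a b → ι (a ℤ.+ b) ≡ ι a ℚ.+ ι b
ι-homo-+ a b = ℚₚ.toℚᵘ-injective (ℚᵘₚ.≃-trans (ι≃mkℚᵘ (a ℤ.+ b)) (ℚᵘₚ.≃-trans
  (*≡* (cong (ℤ._* + 1) (sym (cong₂ ℤ._+_ (ℤₚ.*-identityʳ a) (ℤₚ.*-identityʳ b)))))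
  (ℚᵘₚ.≃-sym (ℚᵘₚ.≃-trans (ℚₚ.toℚᵘ-homo-+ (ι a) (ι b)) (ℚᵘₚ.+-cong (ι≃mkℚᵘ a) (ι≃mkℚᵘ b))))))

ι-homo-* : ∀ a b → ι (a ℤ.* b) ≡ ι a ℚ.* ι b
ι-homo-* a b = ℚₚ.toℚᵘ-injective (ℚᵘₚ.≃-trans (ι≃mkℚᵘ (a ℤ.* b)) (ℚᵘₚ.≃-trans (*≡* refl)
  (ℚᵘₚ.≃-sym (ℚᵘₚ.≃-trans (ℚₚ.toℚᵘ-homo-* (ι a) (ι b)) (ℚᵘₚ.*-cong (ι≃mkℚᵘ a) (ι≃mkℚᵘ b))))))

ι-homo‿- : ∀ a → ι (ℤ.- a) ≡ ℚ.- ι a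
ι-homo‿- a = ℚₚ.toℚᵘ-injective (ℚᵘₚ.≃-trans (ι≃mkℚᵘ (ℤ.- a))
  (ℚᵘₚ.≃-sym (ℚᵘₚ.≃-trans (ℚₚ.toℚᵘ-homo‿- (ι a)) (ℚᵘₚ.-‿cong (ι≃mkℚᵘ a)))))

ι-injective : ∀ a b → ι a ≡ ι b → a ≡ b
ι-injective a b ιa≡ιb with ℚᵘₚ.≃-trans (ℚᵘₚ.≃-sym (ι≃mkℚᵘ a)) (ℚᵘₚ.≃-trans (ℚₚ.toℚᵘ-cong ιa≡ιb) (ι≃mkℚᵘ b))
... | *≡* a*1≡b*1 = trans (sym (ℤₚ.*-identityʳ a)) (trans a*1≡b*1 (ℤₚ.*-identityʳ b))

toGQ-homo-+ : ∀ x y → toGQ (x +ᴳ y) ≡ toGQ x ⊕ toGQ y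
toGQ-homo-+ (gz a b) (gz c d) = cong₂ _+i_ (ι-homo-+ a c) (ι-homo-+ b d)

toGQ-⟪⟫ : ∀ x y → toGQ ⟪ x , y ⟫ ≡ conj (toGQ x) ⊛ toGQ y
toGQ-⟪⟫ (gz a b) (gz c d) = cong₂ _+i_
  (trans (ι-homo-+ (a ℤ.* c) (ℤ.- (ℤ.- b ℤ.* d)))
    (cong₂ ℚ._+_ (ι-homo-* a c) (trans (ι-homo‿- (ℤ.- b ℤ.* d))
      (cong ℚ.-_ (trans (ι-homo-* (ℤ.- b) d) (cong (ℚ._* ι d) (ι-homo‿- b)))))))
  (trans (ι-homo-+ (a ℤ.* d) (ℤ.- b ℤ.* c))
    (cong₂ ℚ._+_ (ι-homo-* a d) (trans (ι-homo-* (ℤ.- b) c) (cong (ℚ._* ι c) (ι-homo‿- b)))))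

toGQ-injective : ∀ x y → toGQ x ≡ toGQ y → x ≡ y
toGQ-injective (gz a b) (gz c d) eq = cong₂ gz (ι-injective a c (cong re eq)) (ι-injective b d (cong im eq))

1+iᵠ ½ᵠ 2ᵠ : GQ
1+iᵠ = toGQ 1+i
½ᵠ = ½ +i 0ℚ
2ᵠ = ι (+ 2) +i 0ℚ

module _ where
  open ℚ-Solver

  inv1+i-cancelˡ : ∀ u → inv1+i ⊛ (1+iᵠ ⊛ u) ≡ u
  inv1+i-cancelˡ (a +i b) = cong₂ _+i_
    (solve 2 (λ a b → (con ½ :* (con 1ℚ :* a :- con 1ℚ :* b)) :- (con -½ :* (con 1ℚ :* b :+ con 1ℚ :* a)) := a) refl a b)
    (solve 2 (λ a b → (con ½ :* (con 1ℚ :* b :+ con 1ℚ :* a)) :+ (con -½ :* (con 1ℚ :* a :- con 1ℚ :* b)) := b) refl a b)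

  1+i-cancelˡ : ∀ u → 1+iᵠ ⊛ (inv1+i ⊛ u) ≡ u
  1+i-cancelˡ (a +i b) = cong₂ _+i_
    (solve 2 (λ a b → (con 1ℚ :* (con ½ :* a :- con -½ :* b)) :- (con 1ℚ :* (con ½ :* b :+ con -½ :* a)) := a) refl a b)
    (solve 2 (λ a b → (con 1ℚ :* (con ½ :* b :+ con -½ :* a)) :+ (con 1ℚ :* (con ½ :* a :- con -½ :* b)) := b) refl a b)

  2-½-cancelˡ : ∀ u → 2ᵠ ⊛ (½ᵠ ⊛ u) ≡ u
  2-½-cancelˡ (a +i b) = cong₂ _+i_
    (solve 2 (λ a b → (con (ι (+ 2)) :* (con ½ :* a :- con 0ℚ :* b)) :- (con 0ℚ :* (con ½ :* b :+ con 0ℚ :* a)) := a) refl a b)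
    (solve 2 (λ a b → (con (ι (+ 2)) :* (con ½ :* b :+ con 0ℚ :* a)) :+ (con 0ℚ :* (con ½ :* a :- con 0ℚ :* b)) := b) refl a b)

  conj-inv1+i-⊛ : ∀ x y → conj (inv1+i ⊛ x) ⊛ (inv1+i ⊛ y) ≡ ½ᵠ ⊛ (conj x ⊛ y)
  conj-inv1+i-⊛ (a +i b) (c +i d) = cong₂ _+i_
    (solve 4 (λ a b c d →
      ((con ½ :* a :- con -½ :* b) :* (con ½ :* c :- con -½ :* d)) :- (:- (con ½ :* b :+ con -½ :* a) :* (con ½ :* d :+ con -½ :* c))
      := (con ½ :* (a :* c :- (:- b) :* d)) :- (con 0ℚ :* (a :* d :+ (:- b) :* c))) refl a b c d)
    (solve 4 (λ a b c d →
      ((con ½ :* a :- con -½ :* b) :* (con ½ :* d :+ con -½ :* c)) :+ (:- (con ½ :* b :+ con -½ :* a) :* (con ½ :* c :- con -½ :* d))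
      := (con ½ :* (a :* d :+ (:- b) :* c)) :+ (con 0ℚ :* (a :* c :- (:- b) :* d))) refl a b c d)

  ⊛-distribˡ-⊕ : ∀ x y z → x ⊛ (y ⊕ z) ≡ (x ⊛ y) ⊕ (x ⊛ z)
  ⊛-distribˡ-⊕ (a +i b) (c +i d) (e +i f) = cong₂ _+i_
    (solve 6 (λ a b c d e f → (a :* (c :+ e)) :- (b :* (d :+ f)) := ((a :* c) :- (b :* d)) :+ ((a :* e) :- (b :* f))) refl a b c d e f)
    (solve 6 (λ a b c d e f → (a :* (d :+ f)) :+ (b :* (c :+ e)) := ((a :* d) :+ (b :* c)) :+ ((a :* f) :+ (b :* e))) refl a b c d e f)

  ⊛-zeroʳ : ∀ x → x ⊛ 𝟘 ≡ 𝟘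
  ⊛-zeroʳ (a +i b) = cong₂ _+i_
    (solve 2 (λ a b → (a :* con 0ℚ) :- (b :* con 0ℚ) := con 0ℚ) refl a b)
    (solve 2 (λ a b → (a :* con 0ℚ) :+ (b :* con 0ℚ) := con 0ℚ) refl a b)

  ⊛-zeroˡ : ∀ x → 𝟘 ⊛ x ≡ 𝟘
  ⊛-zeroˡ (a +i b) = cong₂ _+i_
    (solve 2 (λ a b → (con 0ℚ :* a) :- (con 0ℚ :* b) := con 0ℚ) refl a b)
    (solve 2 (λ a b → (con 0ℚ :* b) :+ (con 0ℚ :* a) := con 0ℚ) refl a b)

  ⊛-identityʳ : ∀ x → x ⊛ 𝟙 ≡ x
  ⊛-identityʳ (a +i b) = cong₂ _+i_
    (solve 2 (λ a b → (a :* con 1ℚ) :- (b :* con 0ℚ) := a) refl a b)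
    (solve 2 (λ a b → (a :* con 0ℚ) :+ (b :* con 1ℚ) := b) refl a b)

  ⊛-identityˡ : ∀ x → 𝟙 ⊛ x ≡ x
  ⊛-identityˡ (a +i b) = cong₂ _+i_
    (solve 2 (λ a b → (con 1ℚ :* a) :- (con 0ℚ :* b) := a) refl a b)
    (solve 2 (λ a b → (con 1ℚ :* b) :+ (con 0ℚ :* a) := b) refl a b)

⊕-commutativeMonoid : CommutativeMonoid 0ℓ 0ℓ
⊕-commutativeMonoid = record
  { Carrier = GQ ; _≈_ = _≡_ ; _∙_ = _⊕_ ; ε = 𝟘
  ; isCommutativeMonoid = record
    { isMonoid = record
      { isSemigroup = record
        { isMagma = record { isEquivalence = isEquivalence ; ∙-cong = cong₂ _⊕_ }
        ; assoc = λ where (a +i b) (c +i d) (e +i f) → cong₂ _+i_ (ℚₚ.+-assoc a c e) (ℚₚ.+-assoc b d f) }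
      ; identity = (λ where (a +i b) → cong₂ _+i_ (ℚₚ.+-identityˡ a) (ℚₚ.+-identityˡ b))
                 , (λ where (a +i b) → cong₂ _+i_ (ℚₚ.+-identityʳ a) (ℚₚ.+-identityʳ b)) }
    ; comm = λ where (a +i b) (c +i d) → cong₂ _+i_ (ℚₚ.+-comm a c) (ℚₚ.+-comm b d) } }

module Σᵠ = Sum ⊕-commutativeMonoid

Σᶠ≡sum : ∀ n (f : Fin n → GQ) → Σᶠ n f ≡ Σᵠ.sum f
Σᶠ≡sum zero f = refl
Σᶠ≡sum (suc n) f = cong (f zero ⊕_) (Σᶠ≡sum n (f ∘ suc))

Σᶠ-cong : ∀ n {f g : Fin n → GQ} → (∀ k → f k ≡ g k) → Σᶠ n f ≡ Σᶠ n g
Σᶠ-cong n {f} {g} f≗g = trans (Σᶠ≡sum n f) (trans (Σᵠ.sum-cong-≗ f≗g) (sym (Σᶠ≡sum n g)))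

Σᶠ-single : ∀ n (f : Fin n → GQ) r → (∀ k → k ≢ r → f k ≡ 𝟘) → Σᶠ n f ≡ f r
Σᶠ-single n f r f≡𝟘 = trans (Σᶠ≡sum n f) (Σᵠ.sum-single f r f≡𝟘)

Σᶠ-toGQ : ∀ n (g : Fin n → GZ) → Σᶠ n (toGQ ∘ g) ≡ toGQ (sumᴳ g)
Σᶠ-toGQ n g = trans (Σᶠ≡sum n (toGQ ∘ g)) (sym (foldr-homomorphic toGQ refl toGQ-homo-+ g))

Σᶠ-⊛ : ∀ n a (f : Fin n → GQ) → Σᶠ n (λ k → a ⊛ f k) ≡ a ⊛ Σᶠ n f
Σᶠ-⊛ n a f = trans (Σᶠ≡sum n _) (trans (sym (foldr-homomorphic (a ⊛_) (⊛-zeroʳ a) (⊛-distribˡ-⊕ a) f))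
  (cong (a ⊛_) (sym (Σᶠ≡sum n f))))

I-diag : ∀ {n} (j : Fin n) → I j j ≡ 𝟙
I-diag j with j Finₚ.≟ j
... | yes _ = refl
... | no j≢j = ⊥-elim (j≢j refl)

I-off : ∀ {n} (i j : Fin n) → i ≢ j → I i j ≡ 𝟘
I-off i j i≢j with i Finₚ.≟ j
... | yes i≡j = ⊥-elim (i≢j i≡j)
... | no _ = refl

PermMat-hit : ∀ {n} (π : Permutation′ n) i k → π ⟨$⟩ʳ i ≡ k → PermMat π i k ≡ 𝟙
PermMat-hit π i k πi≡k with π ⟨$⟩ʳ i Finₚ.≟ k
... | yes _ = refl
... | no πi≢k = ⊥-elim (πi≢k πi≡k)

PermMat-miss : ∀ {n} (π : Permutation′ n) i k → π ⟨$⟩ʳ i ≢ k → PermMat π i k ≡ 𝟘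
PermMat-miss π i k πi≢k with π ⟨$⟩ʳ i Finₚ.≟ k
... | yes πi≡k = ⊥-elim (πi≢k πi≡k)
... | no _ = refl

PermMat-· : ∀ {n} (π : Permutation′ n) (M : Mat n) i j → (PermMat π · M) i j ≡ M (π ⟨$⟩ʳ i) j
PermMat-· {n} π M i j = trans
  (Σᶠ-single n (λ k → PermMat π i k ⊛ M k j) (π ⟨$⟩ʳ i)
    (λ k k≢πi → trans (cong (_⊛ M k j) (PermMat-miss π i k (k≢πi ∘ sym))) (⊛-zeroˡ (M k j))))
  (trans (cong (_⊛ M (π ⟨$⟩ʳ i) j) (PermMat-hit π i _ refl)) (⊛-identityˡ _))

·-PermMat : ∀ {n} (M : Mat n) (τ : Permutation′ n) i j → (M · PermMat τ) i j ≡ M i (τ ⟨$⟩ˡ j)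
·-PermMat {n} M τ i j = trans
  (Σᶠ-single n (λ k → M i k ⊛ PermMat τ k j) (τ ⟨$⟩ˡ j)
    (λ k k≢τ⁻¹j → trans (cong (M i k ⊛_) (PermMat-miss τ k j
      (λ τk≡j → k≢τ⁻¹j (trans (sym (Perm.inverseˡ τ)) (cong (τ ⟨$⟩ˡ_) τk≡j))))) (⊛-zeroʳ (M i k))))
  (trans (cong (M i (τ ⟨$⟩ˡ j) ⊛_) (PermMat-hit τ _ j (Perm.inverseʳ τ))) (⊛-identityʳ _))

Ublk≡blocksₛ : ∀ k s i j → Ublk k s i j ≡ inv1+i ⊛ toGQ ⟦ blocksₛ k s i j ⟧
Ublk≡blocksₛ zero s i j with i Finₚ.≟ j
... | yes _ = refl
... | no _ = refl
Ublk≡blocksₛ (suc k) s zero zero = refl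
Ublk≡blocksₛ (suc k) s zero (suc zero) = refl
Ublk≡blocksₛ (suc k) s (suc zero) zero = refl
Ublk≡blocksₛ (suc k) s (suc zero) (suc zero) = refl
Ublk≡blocksₛ (suc k) s zero (suc (suc j)) = refl
Ublk≡blocksₛ (suc k) s (suc zero) (suc (suc j)) = refl
Ublk≡blocksₛ (suc k) s (suc (suc i)) zero = refl
Ublk≡blocksₛ (suc k) s (suc (suc i)) (suc zero) = refl
Ublk≡blocksₛ (suc k) s (suc (suc i)) (suc (suc j)) = Ublk≡blocksₛ k s i j

castMat-Ublk : ∀ {k s n} (order : k * 2 + s ≡ n) i j →
  castMat order (Ublk k s) i j ≡ inv1+i ⊛ toGQ ⟦ castMatₛ order (blocksₛ k s) i j ⟧
castMat-Ublk {k} {s} refl = Ublk≡blocksₛ k s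

-- The integral matrix (1 + i) U

integral-part : ∀ {n} (U : Mat n) → IsGaussIntMat (scale 1+iᵠ U) →
  Σ (Fin n → Fin n → GZ) λ V → ∀ i j → U i j ≡ inv1+i ⊛ toGQ (V i j)
integral-part {n} U integral = V , λ i j → trans (sym (inv1+i-cancelˡ (U i j))) (cong (inv1+i ⊛_) (V≡ i j))
  where
  V : Fin n → Fin n → GZ
  V i j = gz (proj₁ (proj₁ (integral i j))) (proj₁ (proj₂ (integral i j)))
  V≡ : ∀ i j → 1+iᵠ ⊛ U i j ≡ toGQ (V i j)
  V≡ i j = cong₂ _+i_ (proj₂ (proj₁ (integral i j))) (proj₂ (proj₂ (integral i j)))

module _ {n} {U : Mat n} {V : Fin n → Fin n → GZ} (U≡ : ∀ i j → U i j ≡ inv1+i ⊛ toGQ (V i j)) where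

  column-gram : IsUnitary U → ∀ i j → toGQ (sumᴳ (λ k → ⟪ V k i , V k j ⟫)) ≡ 2ᵠ ⊛ I i j
  column-gram unitary i j = begin
    toGQ (sumᴳ (λ k → ⟪ V k i , V k j ⟫))              ≡⟨ 2-½-cancelˡ _ ⟨
    2ᵠ ⊛ (½ᵠ ⊛ toGQ (sumᴳ (λ k → ⟪ V k i , V k j ⟫)))  ≡⟨ cong (λ x → 2ᵠ ⊛ (½ᵠ ⊛ x)) (Σᶠ-toGQ n _) ⟨
    2ᵠ ⊛ (½ᵠ ⊛ Σᶠ n (λ k → toGQ ⟪ V k i , V k j ⟫))    ≡⟨ cong (2ᵠ ⊛_) (Σᶠ-⊛ n ½ᵠ _) ⟨
    2ᵠ ⊛ Σᶠ n (λ k → ½ᵠ ⊛ toGQ ⟪ V k i , V k j ⟫)      ≡⟨ cong (2ᵠ ⊛_) (Σᶠ-cong n entry) ⟩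
    2ᵠ ⊛ ((U *) · U) i j                               ≡⟨ cong (2ᵠ ⊛_) (unitary i j) ⟩
    2ᵠ ⊛ I i j                                         ∎
    where
    open ≡-Reasoning
    entry : ∀ k → ½ᵠ ⊛ toGQ ⟪ V k i , V k j ⟫ ≡ conj (U k i) ⊛ U k j
    entry k = trans (cong (½ᵠ ⊛_) (toGQ-⟪⟫ (V k i) (V k j)))
      (trans (sym (conj-inv1+i-⊛ (toGQ (V k i)) (toGQ (V k j))))
             (sym (cong₂ (λ x y → conj x ⊛ y) (U≡ k i) (U≡ k j))))

  column-normᴳ : IsUnitary U → ∀ j → sumℕ (λ k → normᴳ (V k j)) ≡ 2
  column-normᴳ unitary j = ℤₚ.+-injective (begin
    + sumℕ (λ k → normᴳ (V k j))            ≡⟨ +-sum (λ k → normᴳ (V k j)) ⟩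
    Σℤ.sum (λ k → + normᴳ (V k j))          ≡⟨ Σℤ.sum-cong-≗ (λ k → gre-⟪x,x⟫ (V k j)) ⟨
    Σℤ.sum (λ k → gre ⟪ V k j , V k j ⟫)    ≡⟨ gre-sum (λ k → ⟪ V k j , V k j ⟫) ⟨
    gre (sumᴳ (λ k → ⟪ V k j , V k j ⟫))    ≡⟨ cong gre (toGQ-injective (sumᴳ (λ k → ⟪ V k j , V k j ⟫)) (gz (+ 2) (+ 0))
                                                  (trans (column-gram unitary j j) (cong (2ᵠ ⊛_) (I-diag j)))) ⟩
    + 2                                     ∎)
    where open ≡-Reasoning

  columns-orthogonalᴳ : IsUnitary U → ∀ i j → i ≢ j → sumᴳ (λ k → ⟪ V k i , V k j ⟫) ≡ 0ᴳ
  columns-orthogonalᴳ unitary i j i≢j =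
    toGQ-injective _ 0ᴳ (trans (column-gram unitary i j) (cong (2ᵠ ⊛_) (I-off i j i≢j)))

  row-sumᴳ : FixesOnes U → ∀ i → sumᴳ (V i) ≡ 1+i
  row-sumᴳ fixes i = toGQ-injective (sumᴳ (V i)) 1+i (begin
    toGQ (sumᴳ (V i))                                ≡⟨ Σᶠ-toGQ n (V i) ⟨
    Σᶠ n (toGQ ∘ V i)                                ≡⟨ 1+i-cancelˡ _ ⟨
    1+iᵠ ⊛ (inv1+i ⊛ Σᶠ n (toGQ ∘ V i))              ≡⟨ cong (1+iᵠ ⊛_) (Σᶠ-⊛ n inv1+i _) ⟨
    1+iᵠ ⊛ Σᶠ n (λ j → inv1+i ⊛ toGQ (V i j))        ≡⟨ cong (1+iᵠ ⊛_) (Σᶠ-cong n (λ j → sym (U≡ i j))) ⟩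
    1+iᵠ ⊛ Σᶠ n (U i)                                ≡⟨ cong (1+iᵠ ⊛_) (fixes i) ⟩
    1+iᵠ ⊛ 𝟙                                         ≡⟨ ⊛-identityʳ 1+iᵠ ⟩
    toGQ 1+i                                         ∎)
    where open ≡-Reasoning

  small-part : IsUnitary U → Σ (MatS n) λ W → ∀ i j → ⟦ W i j ⟧ ≡ V i j
  small-part unitary = (λ i j → proj₁ (small i j)) , (λ i j → proj₂ (small i j))
    where
    small : ∀ i j → Σ Small λ e → ⟦ e ⟧ ≡ V i j
    small i j = normᴳ≤2⇒small (V i j)
      (subst (normᴳ (V i j) ≤_) (column-normᴳ unitary j) (≤-sum (λ k → normᴳ (V k j)) i))

  admissible : IsUnitary U → FixesOnes U → {W : MatS n} → (∀ i j → ⟦ W i j ⟧ ≡ V i j) → Admissible W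
  admissible unitary fixes ⟦W⟧≡V = record
    { column-norm = λ j → trans (Σℕ.sum-cong-≗ (λ k → cong normᴳ (⟦W⟧≡V k j))) (column-normᴳ unitary j)
    ; columns-orthogonal = λ i j i≢j →
        trans (Σᴳ.sum-cong-≗ (λ k → cong₂ ⟪_,_⟫ (⟦W⟧≡V k i) (⟦W⟧≡V k j))) (columns-orthogonalᴳ unitary i j i≢j)
    ; row-sum = λ i → trans (Σᴳ.sum-cong-≗ (⟦W⟧≡V i)) (row-sumᴳ fixes i)
    }

module _ {n} {U : Mat n} {W : MatS n} (U≡ : ∀ i j → U i j ≡ inv1+i ⊛ toGQ ⟦ W i j ⟧) where

  permuted-Ublk : (F : BlockForm W) → let open BlockForm F in
    ∀ i j → ((PermMat σ · U) · PermMat (Perm.flip ρ)) i j ≡ castMat order (Ublk k s) i j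
  permuted-Ublk F i j = begin
    ((PermMat σ · U) · PermMat (Perm.flip ρ)) i j   ≡⟨ ·-PermMat (PermMat σ · U) (Perm.flip ρ) i j ⟩
    (PermMat σ · U) i (ρ ⟨$⟩ʳ j)                    ≡⟨ PermMat-· σ U i (ρ ⟨$⟩ʳ j) ⟩
    U (σ ⟨$⟩ʳ i) (ρ ⟨$⟩ʳ j)                         ≡⟨ U≡ _ _ ⟩
    inv1+i ⊛ toGQ ⟦ W (σ ⟨$⟩ʳ i) (ρ ⟨$⟩ʳ j) ⟧        ≡⟨ cong (λ e → inv1+i ⊛ toGQ ⟦ e ⟧) (shape i j) ⟩
    inv1+i ⊛ toGQ ⟦ castMatₛ order (blocksₛ k s) i j ⟧ ≡⟨ castMat-Ublk {k} {s} order i j ⟨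
    castMat order (Ublk k s) i j                    ∎
    where
    open ≡-Reasoning
    open BlockForm F

  diagonal⇒integral : ∀ {s} (order : 0 * 2 + s ≡ n) (σ ρ : Permutation′ n) →
    (∀ i j → W (σ ⟨$⟩ʳ i) (ρ ⟨$⟩ʳ j) ≡ castMatₛ order (blocksₛ 0 s) i j) → IsGaussIntMat (scale 𝟙 U)
  diagonal⇒integral order σ ρ shape i j = subst (λ u → IsGaussInt (𝟙 ⊛ u)) (sym (U≡ i j)) (integral (W i j) W≡)
    where
    integral : ∀ e → e ≡ 0ₛ ⊎ e ≡ 1+iₛ → IsGaussInt (𝟙 ⊛ (inv1+i ⊛ toGQ ⟦ e ⟧))
    integral .0ₛ (inj₁ refl) = (+ 0 , refl) , (+ 0 , refl)
    integral .1+iₛ (inj₂ refl) = (+ 1 , refl) , (+ 0 , refl)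
    W≡ : W i j ≡ 0ₛ ⊎ W i j ≡ 1+iₛ
    W≡ = subst (λ e → e ≡ 0ₛ ⊎ e ≡ 1+iₛ) (cong₂ W (Perm.inverseʳ σ) (Perm.inverseʳ ρ))
           (subst (λ e → e ≡ 0ₛ ⊎ e ≡ 1+iₛ) (sym (shape _ _)) (castMatₛ-diagₛ order (σ ⟨$⟩ˡ i) (ρ ⟨$⟩ˡ j)))

  level-1+i⇒blocks : (∀ ℓ → InΓ ℓ → IsGaussIntMat (scale (toGQ ℓ) U) → N (gz (+ 1) (+ 1)) ℤ.≤ N ℓ) →
    BlockForm W → Σ (Permutation′ n) λ π → Σ (Permutation′ n) λ τ → Σ ℕ λ k → Σ ℕ λ s
      → Σ (k * 2 + s ≡ n) λ eq → (1 ≤ k)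
        × (∀ i j → ((PermMat π · U) · PermMat τ) i j ≡ castMat eq (Ublk k s) i j)
  level-1+i⇒blocks minimal record { k = zero ; order = order ; σ = σ ; ρ = ρ ; shape = shape } =
    -- with no block, U is a permutation matrix and 1 would be a smaller level
    ⊥-elim (level≰1 (minimal (gz (+ 1) (+ 0)) (ℤ.+<+ (s≤s z≤n) , ℤ.+≤+ z≤n) (diagonal⇒integral order σ ρ shape)))
    where
    level≰1 : ¬ (N (gz (+ 1) (+ 1)) ℤ.≤ N (gz (+ 1) (+ 0)))
    level≰1 (ℤ.+≤+ (s≤s ()))
  level-1+i⇒blocks minimal F@record { k = suc k ; s = s ; order = order ; σ = σ ; ρ = ρ } =
    σ , Perm.flip ρ , suc k , s , order , s≤s z≤n , permuted-Ublk F

lemma34 : (n : ℕ) (U : Mat n) → IsUnitary U → FixesOnes U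
    → IsLevel U (gz (+ 1) (+ 1))
    → Σ (Permutation′ n) λ π → Σ (Permutation′ n) λ τ → Σ ℕ λ k → Σ ℕ λ s
      → Σ (k * 2 + s ≡ n) λ eq → (1 ≤ k)
        × (∀ i j → ((PermMat π · U) · PermMat τ) i j ≡ castMat eq (Ublk k s) i j)
lemma34 n U unitary fixes (_ , integral , minimal) =
  level-1+i⇒blocks {W = W} U≡W minimal (blockForm n W (admissible {V = V} U≡V unitary fixes ⟦W⟧≡V))
  where
  V : Fin n → Fin n → GZ
  V = proj₁ (integral-part U integral)
  U≡V : ∀ i j → U i j ≡ inv1+i ⊛ toGQ (V i j)
  U≡V = proj₂ (integral-part U integral)
  W : MatS n
  W = proj₁ (small-part {V = V} U≡V unitary)
  ⟦W⟧≡V : ∀ i j → ⟦ W i j ⟧ ≡ V i j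
  ⟦W⟧≡V = proj₂ (small-part {V = V} U≡V unitary)
  U≡W : ∀ i j → U i j ≡ inv1+i ⊛ toGQ ⟦ W i j ⟧
  U≡W i j = trans (U≡V i j) (cong (λ x → inv1+i ⊛ toGQ x) (sym (⟦W⟧≡V i j)))
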